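{- Let $m\geq n+1$ and let $S\subseteq S'\subseteq[m]$ with $|S|\geq n$ and $|S'\setminus S|=1$. Then the concentration map $\phi_S^{S'}:\mathcal{F}_n^{S'}\to\mathcal{F}_n^{S}$ satisfies: 1) for each $A\in\mathcal{F}_n^{S'}$, $d(A,\phi_S^{S'}(A))\in\{0,2\}$; 2) for any $A,B\in\mathcal{F}_n^{S'}$ with $A\neq B$, $d(\phi_S^{S'}(A),\phi_S^{S'}(B))\in\{d(A,B),\,d(A,B)-2\}$. Hence $\phi_S^{S'}$ is a contraction, and it induces a simplicial map $\mathcal{VR}(\mathcal{F}_n^{S'};r)\to\mathcal{VR}(\mathcal{F}_n^{S};r)$ for every $r\geq 0$.
   Context: For $U\subseteq[m]$ with $|U|\ge n$, $\mathcal{F}_n^{U}$ is the set of $n$-element subsets of $U$ with metric $d(A,B)=|A\triangle B|$. For $S\subseteq S'$ with $|S|\ge n$, the concentration map $\phi_S^{S'}$ sends $A\in\mathcal{F}_n^{S'}$ to the union of $A\cap S$ with the $|A\setminus S|$ smallest elements of $S\setminus A$. A map $f:X\to Y$ from a metric space onto a subspace $Y\subseteq X$ is a contraction if $f|_Y=\mathrm{id}_Y$ and $d(f(x),f(y))\le d(x,y)$ for all $x,y$. $\mathcal{VR}(X;r)$ is the simplicial complex on $X$ whose simplices are nonempty finite sets of pairwise distance $\le r$. -}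

module Defs where

open import Data.Nat using (ℕ; zero; suc; _≤_)
open import Data.Bool using (true; false)
open import Data.Vec using (Vec; []; _∷_)
open import Data.List using (List; []; _∷_; map)
open import Data.List.Membership.Propositional using () renaming (_∈_ to _∈ₗ_)
open import Data.Product using (_×_)
open import Relation.Binary.PropositionalEquality using (_≡_)
open import Data.Fin.Subset using (Subset; _⊆_; _∩_; _∪_; _─_; ∣_∣; inside; outside)

-- [m] is modelled as Fin m = {0,…,m-1} with its usual order
-- (order-isomorphic to {1,…,m}); subsets of [m] are Subset m.

InF : ∀ {m} → ℕ → Subset m → Subset m → Set
InF n U A = (A ⊆ U) × (∣ A ∣ ≡ n)

_△_ : ∀ {m} → Subset m → Subset m → Subset m
A △ B = (A ─ B) ∪ (B ─ A)

dist : ∀ {m} → Subset m → Subset m → ℕ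
dist A B = ∣ A △ B ∣

-- smallest k T : the set of the k smallest elements of T
-- (all of T if |T| < k; never used in that case below)
smallest : ∀ {m} → ℕ → Subset m → Subset m
smallest k [] = []
smallest zero (x ∷ T) = outside ∷ smallest zero T
smallest (suc k) (true ∷ T) = inside ∷ smallest k T
smallest (suc k) (false ∷ T) = outside ∷ smallest (suc k) T

-- concentration map φ_S^{S'} (it does not depend on S' as a function of A):
-- A ↦ (A ∩ S) ∪ (the |A ∖ S| smallest elements of S ∖ A)
conc : ∀ {m} → Subset m → Subset m → Subset m
conc S A = (A ∩ S) ∪ smallest ∣ A ─ S ∣ (S ─ A)

IsContraction : ∀ {m} → ℕ → Subset m → Subset m → (Subset m → Subset m) → Set
IsContraction n S S' f =
  (∀ A → InF n S' A → InF n S (f A)) ×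
  (∀ A → InF n S A → f A ≡ A) ×
  (∀ A B → InF n S' A → InF n S' B → dist (f A) (f B) ≤ dist A B)

-- simplices of VR(F_n^U ; r): nonempty finite sets (given as lists) of
-- vertices of F_n^U with pairwise distance ≤ r
data NonEmpty {A : Set} : List A → Set where
  nonempty : ∀ {x xs} → NonEmpty (x ∷ xs)

IsVRSimplex : ∀ {m} → ℕ → Subset m → ℕ → List (Subset m) → Set
IsVRSimplex n U r σ =
  NonEmpty σ ×
  (∀ A → A ∈ₗ σ → InF n U A) ×
  (∀ A B → A ∈ₗ σ → B ∈ₗ σ → dist A B ≤ r)

IsSimplicialVR : ∀ {m} → ℕ → Subset m → Subset m → ℕ → (Subset m → Subset m) → Set
IsSimplicialVR n S' S r f =
  (∀ A → InF n S' A → InF n S (f A)) ×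
  (∀ σ → IsVRSimplex n S' r σ → IsVRSimplex n S r (map f σ))

{-# OPTIONS --safe #-}
-- Since S' ∖ S is a single point, a vertex A of F_n^{S'} has at most one element outside S, and φ
-- replaces it by the least element of S ∖ A; so d(A, φ A) = 2|A ∖ S| ∈ {0, 2}. The distance d(A, B)
-- splits as d(A ∩ S, B ∩ S) plus the disagreement of A and B outside S, which is 0 or 1. If only one
-- of A, B has a point outside S, adding one point inside S changes d(A ∩ S, B ∩ S) by ±1, so in total
-- d stays or drops by 2. If both do, they gain the least points a of S ∖ A and b of S ∖ B; when a < b,
-- a ∈ B removes a disagreement, while b adds one (b ∉ A) or removes one (b ∈ A).
module Submission where

open import Defs
open import Data.Nat using (ℕ; zero; suc; _+_; _≤_; z≤n; s≤s; ∣_-_∣)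
open import Data.Nat.Properties
  using (+-suc; +-comm; +-cancelˡ-≤; ≤-trans; ≤-reflexive; n≤0⇒n≡0; m≤m+n; module ≤-Reasoning)
open import Data.Vec using ([]; _∷_; here)
open import Data.List using (_∷_; map)
open import Data.List.Membership.Propositional using (_∈_)
open import Data.List.Membership.Propositional.Properties using (∈-map⁻)
open import Data.Fin.Subset using (Subset; _⊆_; _─_; _∩_; _∪_; ∣_∣; ⊥; inside; outside)
open import Data.Fin.Subset.Properties
  using (drop-∷-⊆; out⊆; in⊆in; p⊆q⇒∣p∣≤∣q∣; ∣⊥∣≡0; ∩-comm; ∪-comm; ∪-identityʳ; p∩q⊆q; p─q⊆p; x∈p∪q⁻)
open import Data.Product using (_×_; _,_; proj₁; proj₂)
open import Data.Sum using (_⊎_; inj₁; inj₂; [_,_])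
import Data.Sum as Sum
open import Data.Empty using (⊥-elim)
open import Function using (_∘_)
open import Relation.Nullary using (¬_)
open import Relation.Binary.PropositionalEquality
  using (_≡_; _≢_; refl; sym; trans; cong; cong₂; subst; subst₂; module ≡-Reasoning)

private
  variable
    m : ℕ

in⊈out : {p q : Subset m} → ¬ (inside ∷ p ⊆ outside ∷ q)
in⊈out p⊆q with p⊆q here
... | ()

p⊆q⇒p∩q≡p : {p q : Subset m} → p ⊆ q → p ∩ q ≡ p
p⊆q⇒p∩q≡p {p = []}          {[]}          _   = refl
p⊆q⇒p∩q≡p {p = outside ∷ p} {_ ∷ q}       p⊆q = cong (outside ∷_) (p⊆q⇒p∩q≡p (drop-∷-⊆ p⊆q))
p⊆q⇒p∩q≡p {p = inside ∷ p}  {inside ∷ q}  p⊆q = cong (inside ∷_) (p⊆q⇒p∩q≡p (drop-∷-⊆ p⊆q))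
p⊆q⇒p∩q≡p {p = inside ∷ p}  {outside ∷ q} p⊆q = ⊥-elim (in⊈out p⊆q)

p⊆q⇒p─q≡⊥ : {p q : Subset m} → p ⊆ q → p ─ q ≡ ⊥
p⊆q⇒p─q≡⊥ {p = []}          {[]}          _   = refl
p⊆q⇒p─q≡⊥ {p = x ∷ p}       {inside ∷ q}  p⊆q = cong (outside ∷_) (p⊆q⇒p─q≡⊥ (drop-∷-⊆ p⊆q))
p⊆q⇒p─q≡⊥ {p = outside ∷ p} {outside ∷ q} p⊆q = cong (outside ∷_) (p⊆q⇒p─q≡⊥ (drop-∷-⊆ p⊆q))
p⊆q⇒p─q≡⊥ {p = inside ∷ p}  {outside ∷ q} p⊆q = ⊥-elim (in⊈out p⊆q)

p⊆q⇒p─r⊆q─r : {p q : Subset m} (r : Subset m) → p ⊆ q → p ─ r ⊆ q ─ r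
p⊆q⇒p─r⊆q─r {p = x ∷ p}       {y ∷ q}       (inside ∷ r)  p⊆q = out⊆ (p⊆q⇒p─r⊆q─r r (drop-∷-⊆ p⊆q))
p⊆q⇒p─r⊆q─r {p = outside ∷ p} {y ∷ q}       (outside ∷ r) p⊆q = out⊆ (p⊆q⇒p─r⊆q─r r (drop-∷-⊆ p⊆q))
p⊆q⇒p─r⊆q─r {p = inside ∷ p}  {inside ∷ q}  (outside ∷ r) p⊆q = in⊆in (p⊆q⇒p─r⊆q─r r (drop-∷-⊆ p⊆q))
p⊆q⇒p─r⊆q─r {p = inside ∷ p}  {outside ∷ q} (outside ∷ r) p⊆q = ⊥-elim (in⊈out p⊆q)

p⊆q⇒∣p─r∣≤∣q─r∣ : {p q : Subset m} (r : Subset m) → p ⊆ q → ∣ p ─ r ∣ ≤ ∣ q ─ r ∣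
p⊆q⇒∣p─r∣≤∣q─r∣ r = p⊆q⇒∣p∣≤∣q∣ ∘ p⊆q⇒p─r⊆q─r r

∣p∣≡∣p∩q∣+∣p─q∣ : (p q : Subset m) → ∣ p ∣ ≡ ∣ p ∩ q ∣ + ∣ p ─ q ∣
∣p∣≡∣p∩q∣+∣p─q∣ []            []            = refl
∣p∣≡∣p∩q∣+∣p─q∣ (inside ∷ p)  (inside ∷ q)  = cong suc (∣p∣≡∣p∩q∣+∣p─q∣ p q)
∣p∣≡∣p∩q∣+∣p─q∣ (inside ∷ p)  (outside ∷ q) =
  trans (cong suc (∣p∣≡∣p∩q∣+∣p─q∣ p q)) (sym (+-suc ∣ p ∩ q ∣ ∣ p ─ q ∣))
∣p∣≡∣p∩q∣+∣p─q∣ (outside ∷ p) (inside ∷ q)  = ∣p∣≡∣p∩q∣+∣p─q∣ p q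
∣p∣≡∣p∩q∣+∣p─q∣ (outside ∷ p) (outside ∷ q) = ∣p∣≡∣p∩q∣+∣p─q∣ p q

∣p∣≤∣q∣⇒∣p─q∣≤∣q─p∣ : (p q : Subset m) → ∣ p ∣ ≤ ∣ q ∣ → ∣ p ─ q ∣ ≤ ∣ q ─ p ∣
∣p∣≤∣q∣⇒∣p─q∣≤∣q─p∣ p q ∣p∣≤∣q∣ = +-cancelˡ-≤ ∣ p ∩ q ∣ _ _ (begin
  ∣ p ∩ q ∣ + ∣ p ─ q ∣ ≡⟨ ∣p∣≡∣p∩q∣+∣p─q∣ p q ⟨
  ∣ p ∣                 ≤⟨ ∣p∣≤∣q∣ ⟩
  ∣ q ∣                 ≡⟨ ∣p∣≡∣p∩q∣+∣p─q∣ q p ⟩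
  ∣ q ∩ p ∣ + ∣ q ─ p ∣ ≡⟨ cong (λ s → ∣ s ∣ + ∣ q ─ p ∣) (∩-comm q p) ⟩
  ∣ p ∩ q ∣ + ∣ q ─ p ∣ ∎)
  where open ≤-Reasoning

dist-comm : (p q : Subset m) → dist p q ≡ dist q p
dist-comm p q = cong ∣_∣ (∪-comm (p ─ q) (q ─ p))

dist-─-∩ : (r p q : Subset m) → dist p q ≡ dist (p ─ r) (q ─ r) + dist (p ∩ r) (q ∩ r)
dist-─-∩ []            []            []            = refl
dist-─-∩ (inside ∷ r)  (inside ∷ p)  (inside ∷ q)  = dist-─-∩ r p q
dist-─-∩ (inside ∷ r)  (inside ∷ p)  (outside ∷ q) = trans (cong suc (dist-─-∩ r p q)) (sym (+-suc _ _))
dist-─-∩ (inside ∷ r)  (outside ∷ p) (inside ∷ q)  = trans (cong suc (dist-─-∩ r p q)) (sym (+-suc _ _))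
dist-─-∩ (inside ∷ r)  (outside ∷ p) (outside ∷ q) = dist-─-∩ r p q
dist-─-∩ (outside ∷ r) (inside ∷ p)  (inside ∷ q)  = dist-─-∩ r p q
dist-─-∩ (outside ∷ r) (inside ∷ p)  (outside ∷ q) = cong suc (dist-─-∩ r p q)
dist-─-∩ (outside ∷ r) (outside ∷ p) (inside ∷ q)  = cong suc (dist-─-∩ r p q)
dist-─-∩ (outside ∷ r) (outside ∷ p) (outside ∷ q) = dist-─-∩ r p q

∣p∣≡0∧∣q∣≡0⇒dist≡0 : (p q : Subset m) → ∣ p ∣ ≡ 0 → ∣ q ∣ ≡ 0 → dist p q ≡ 0
∣p∣≡0∧∣q∣≡0⇒dist≡0 []            []            _     _     = refl
∣p∣≡0∧∣q∣≡0⇒dist≡0 (outside ∷ p) (outside ∷ q) ∣p∣≡0 ∣q∣≡0 = ∣p∣≡0∧∣q∣≡0⇒dist≡0 p q ∣p∣≡0 ∣q∣≡0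
∣p∣≡0∧∣q∣≡0⇒dist≡0 (outside ∷ p) (inside ∷ q)  _     ()
∣p∣≡0∧∣q∣≡0⇒dist≡0 (inside ∷ p)  _             ()    _

dist-⊆-∣r∣≤1 : {p q r : Subset m} → p ⊆ r → q ⊆ r → ∣ r ∣ ≤ 1 → dist p q ≡ ∣ ∣ p ∣ - ∣ q ∣ ∣
dist-⊆-∣r∣≤1 {p = []} {[]} {[]} _ _ _ = refl
dist-⊆-∣r∣≤1 {p = outside ∷ p} {outside ∷ q} {outside ∷ r} p⊆r q⊆r ∣r∣≤1 =
  dist-⊆-∣r∣≤1 (drop-∷-⊆ p⊆r) (drop-∷-⊆ q⊆r) ∣r∣≤1
dist-⊆-∣r∣≤1 {p = inside ∷ p}  {_}           {outside ∷ r} p⊆r _ _ = ⊥-elim (in⊈out p⊆r)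
dist-⊆-∣r∣≤1 {p = outside ∷ p} {inside ∷ q}  {outside ∷ r} _ q⊆r _ = ⊥-elim (in⊈out q⊆r)
dist-⊆-∣r∣≤1 {m = suc m} {x ∷ p} {y ∷ q} {inside ∷ r} p⊆r q⊆r (s≤s ∣r∣≤0) = heads x y
  where
  empty : {s : Subset m} → s ⊆ r → ∣ s ∣ ≡ 0
  empty s⊆r = n≤0⇒n≡0 (≤-trans (p⊆q⇒∣p∣≤∣q∣ s⊆r) ∣r∣≤0)
  ∣p∣≡0 : ∣ p ∣ ≡ 0
  ∣p∣≡0 = empty (drop-∷-⊆ p⊆r)
  ∣q∣≡0 : ∣ q ∣ ≡ 0
  ∣q∣≡0 = empty (drop-∷-⊆ q⊆r)
  dist≡0 : dist p q ≡ 0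
  dist≡0 = ∣p∣≡0∧∣q∣≡0⇒dist≡0 p q ∣p∣≡0 ∣q∣≡0
  heads : ∀ x y → dist (x ∷ p) (y ∷ q) ≡ ∣ ∣ x ∷ p ∣ - ∣ y ∷ q ∣ ∣
  heads inside  inside  rewrite ∣p∣≡0 | ∣q∣≡0 = dist≡0
  heads inside  outside rewrite ∣p∣≡0 | ∣q∣≡0 = cong suc dist≡0
  heads outside inside  rewrite ∣p∣≡0 | ∣q∣≡0 = cong suc dist≡0
  heads outside outside rewrite ∣p∣≡0 | ∣q∣≡0 = dist≡0

smallest-zero : (T : Subset m) → smallest 0 T ≡ ⊥
smallest-zero []      = refl
smallest-zero (_ ∷ T) = cong (outside ∷_) (smallest-zero T)

smallest-⊆ : ∀ k (T : Subset m) → smallest k T ⊆ T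
smallest-⊆ zero    (_ ∷ T)       = out⊆ (smallest-⊆ zero T)
smallest-⊆ (suc k) (inside ∷ T)  = in⊆in (smallest-⊆ k T)
smallest-⊆ (suc k) (outside ∷ T) = out⊆ (smallest-⊆ (suc k) T)

∣smallest∣ : ∀ k (T : Subset m) → k ≤ ∣ T ∣ → ∣ smallest k T ∣ ≡ k
∣smallest∣ zero    []            _       = refl
∣smallest∣ zero    (_ ∷ T)       _       = ∣smallest∣ zero T z≤n
∣smallest∣ (suc k) (inside ∷ T)  (s≤s k≤) = cong suc (∣smallest∣ k T k≤)
∣smallest∣ (suc k) (outside ∷ T) k<      = ∣smallest∣ (suc k) T k<

∣p∩q∪r∣≡∣p∩q∣+∣r∣ : (p q r : Subset m) → r ⊆ q ─ p → ∣ p ∩ q ∪ r ∣ ≡ ∣ p ∩ q ∣ + ∣ r ∣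
∣p∩q∪r∣≡∣p∩q∣+∣r∣ []            []            []            _   = refl
∣p∩q∪r∣≡∣p∩q∣+∣r∣ (inside ∷ p)  (inside ∷ q)  (outside ∷ r) r⊆ = cong suc (∣p∩q∪r∣≡∣p∩q∣+∣r∣ p q r (drop-∷-⊆ r⊆))
∣p∩q∪r∣≡∣p∩q∣+∣r∣ (outside ∷ p) (inside ∷ q)  (outside ∷ r) r⊆ = ∣p∩q∪r∣≡∣p∩q∣+∣r∣ p q r (drop-∷-⊆ r⊆)
∣p∩q∪r∣≡∣p∩q∣+∣r∣ (outside ∷ p) (inside ∷ q)  (inside ∷ r)  r⊆ =
  trans (cong suc (∣p∩q∪r∣≡∣p∩q∣+∣r∣ p q r (drop-∷-⊆ r⊆))) (sym (+-suc ∣ p ∩ q ∣ ∣ r ∣))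
∣p∩q∪r∣≡∣p∩q∣+∣r∣ (inside ∷ p)  (outside ∷ q) (outside ∷ r) r⊆ = ∣p∩q∪r∣≡∣p∩q∣+∣r∣ p q r (drop-∷-⊆ r⊆)
∣p∩q∪r∣≡∣p∩q∣+∣r∣ (outside ∷ p) (outside ∷ q) (outside ∷ r) r⊆ = ∣p∩q∪r∣≡∣p∩q∣+∣r∣ p q r (drop-∷-⊆ r⊆)
∣p∩q∪r∣≡∣p∩q∣+∣r∣ (inside ∷ p)  (inside ∷ q)  (inside ∷ r)  r⊆ = ⊥-elim (in⊈out r⊆)
∣p∩q∪r∣≡∣p∩q∣+∣r∣ (inside ∷ p)  (outside ∷ q) (inside ∷ r)  r⊆ = ⊥-elim (in⊈out r⊆)
∣p∩q∪r∣≡∣p∩q∣+∣r∣ (outside ∷ p) (outside ∷ q) (inside ∷ r)  r⊆ = ⊥-elim (in⊈out r⊆)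

dist-p∩q∪r : (p q r : Subset m) → r ⊆ q ─ p → dist p (p ∩ q ∪ r) ≡ ∣ p ─ q ∣ + ∣ r ∣
dist-p∩q∪r []            []            []            _   = refl
dist-p∩q∪r (inside ∷ p)  (inside ∷ q)  (outside ∷ r) r⊆ = dist-p∩q∪r p q r (drop-∷-⊆ r⊆)
dist-p∩q∪r (outside ∷ p) (inside ∷ q)  (outside ∷ r) r⊆ = dist-p∩q∪r p q r (drop-∷-⊆ r⊆)
dist-p∩q∪r (outside ∷ p) (inside ∷ q)  (inside ∷ r)  r⊆ =
  trans (cong suc (dist-p∩q∪r p q r (drop-∷-⊆ r⊆))) (sym (+-suc ∣ p ─ q ∣ ∣ r ∣))
dist-p∩q∪r (inside ∷ p)  (outside ∷ q) (outside ∷ r) r⊆ = cong suc (dist-p∩q∪r p q r (drop-∷-⊆ r⊆))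
dist-p∩q∪r (outside ∷ p) (outside ∷ q) (outside ∷ r) r⊆ = dist-p∩q∪r p q r (drop-∷-⊆ r⊆)
dist-p∩q∪r (inside ∷ p)  (inside ∷ q)  (inside ∷ r)  r⊆ = ⊥-elim (in⊈out r⊆)
dist-p∩q∪r (inside ∷ p)  (outside ∷ q) (inside ∷ r)  r⊆ = ⊥-elim (in⊈out r⊆)
dist-p∩q∪r (outside ∷ p) (outside ∷ q) (inside ∷ r)  r⊆ = ⊥-elim (in⊈out r⊆)

-- conc S A is definitionally concBy ∣ A ─ S ∣ S A.
concBy : ℕ → Subset m → Subset m → Subset m
concBy k S A = A ∩ S ∪ smallest k (S ─ A)

concBy-zero : (S A : Subset m) → concBy 0 S A ≡ A ∩ S
concBy-zero S A = trans (cong (A ∩ S ∪_) (smallest-zero (S ─ A))) (∪-identityʳ (A ∩ S))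

OffByOne : ℕ → ℕ → Set
OffByOne D d = D ≡ suc d ⊎ suc D ≡ d

SameOrTwoLess : ℕ → ℕ → Set
SameOrTwoLess D d = D ≡ d ⊎ D + 2 ≡ d

OffByOne-suc : {D d : ℕ} → OffByOne D d → OffByOne (suc D) (suc d)
OffByOne-suc = Sum.map (cong suc) (cong suc)

OffByOne⇒SameOrTwoLess : {D d : ℕ} → OffByOne D d → SameOrTwoLess D (suc d)
OffByOne⇒SameOrTwoLess     (inj₁ D≡1+d) = inj₁ D≡1+d
OffByOne⇒SameOrTwoLess {D} (inj₂ 1+D≡d) = inj₂ (trans (+-comm D 2) (cong suc 1+D≡d))

SameOrTwoLess⇒≤ : {D d : ℕ} → SameOrTwoLess D d → D ≤ d
SameOrTwoLess⇒≤     (inj₁ D≡d)   = ≤-reflexive D≡d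
SameOrTwoLess⇒≤ {D} (inj₂ D+2≡d) = subst (D ≤_) D+2≡d (m≤m+n D 2)

dist-concBy-one : (S A Y : Subset m) → 1 ≤ ∣ S ─ A ∣ → OffByOne (dist (concBy 1 S A) Y) (dist (A ∩ S) Y)
dist-concBy-one []            []            []            ()
dist-concBy-one (inside ∷ S)  (inside ∷ A)  (inside ∷ Y)  h = dist-concBy-one S A Y h
dist-concBy-one (inside ∷ S)  (inside ∷ A)  (outside ∷ Y) h = OffByOne-suc (dist-concBy-one S A Y h)
dist-concBy-one (inside ∷ S)  (outside ∷ A) (inside ∷ Y)  _ = inj₂ (cong (λ X → suc (dist X Y)) (concBy-zero S A))
dist-concBy-one (inside ∷ S)  (outside ∷ A) (outside ∷ Y) _ = inj₁ (cong (λ X → suc (dist X Y)) (concBy-zero S A))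
dist-concBy-one (outside ∷ S) (inside ∷ A)  (inside ∷ Y)  h = OffByOne-suc (dist-concBy-one S A Y h)
dist-concBy-one (outside ∷ S) (inside ∷ A)  (outside ∷ Y) h = dist-concBy-one S A Y h
dist-concBy-one (outside ∷ S) (outside ∷ A) (inside ∷ Y)  h = OffByOne-suc (dist-concBy-one S A Y h)
dist-concBy-one (outside ∷ S) (outside ∷ A) (outside ∷ Y) h = dist-concBy-one S A Y h

dist-concBy-one-zero : (S A B : Subset m) → 1 ≤ ∣ S ─ A ∣ →
  SameOrTwoLess (dist (concBy 1 S A) (concBy 0 S B)) (suc (dist (A ∩ S) (B ∩ S)))
dist-concBy-one-zero S A B h =
  subst (λ X → SameOrTwoLess (dist (concBy 1 S A) X) (suc (dist (A ∩ S) (B ∩ S))))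
    (sym (concBy-zero S B)) (OffByOne⇒SameOrTwoLess (dist-concBy-one S A (B ∩ S) h))

dist-concBy-zero-one : (S A B : Subset m) → 1 ≤ ∣ S ─ B ∣ →
  SameOrTwoLess (dist (concBy 0 S A) (concBy 1 S B)) (suc (dist (A ∩ S) (B ∩ S)))
dist-concBy-zero-one S A B h =
  subst₂ SameOrTwoLess (dist-comm (concBy 1 S B) (concBy 0 S A)) (cong suc (dist-comm (B ∩ S) (A ∩ S)))
    (dist-concBy-one-zero S B A h)

dist-concBy-one-one : (S A B : Subset m) → 1 ≤ ∣ S ─ A ∣ → 1 ≤ ∣ S ─ B ∣ →
  SameOrTwoLess (dist (concBy 1 S A) (concBy 1 S B)) (dist (A ∩ S) (B ∩ S))
dist-concBy-one-one []            []            []            ()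
dist-concBy-one-one (inside ∷ S)  (inside ∷ A)  (inside ∷ B)  hA hB = dist-concBy-one-one S A B hA hB
dist-concBy-one-one (inside ∷ S)  (inside ∷ A)  (outside ∷ B) hA _  = dist-concBy-one-zero S A B hA
dist-concBy-one-one (inside ∷ S)  (outside ∷ A) (inside ∷ B)  _  hB = dist-concBy-zero-one S A B hB
dist-concBy-one-one (inside ∷ S)  (outside ∷ A) (outside ∷ B) _  _  =
  inj₁ (cong₂ dist (concBy-zero S A) (concBy-zero S B))
dist-concBy-one-one (outside ∷ S) (inside ∷ A)  (inside ∷ B)  hA hB = dist-concBy-one-one S A B hA hB
dist-concBy-one-one (outside ∷ S) (inside ∷ A)  (outside ∷ B) hA hB = dist-concBy-one-one S A B hA hB
dist-concBy-one-one (outside ∷ S) (outside ∷ A) (inside ∷ B)  hA hB = dist-concBy-one-one S A B hA hB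
dist-concBy-one-one (outside ∷ S) (outside ∷ A) (outside ∷ B) hA hB = dist-concBy-one-one S A B hA hB

dist-concBy : ∀ ka kb (S A B : Subset m) → ka ≤ 1 → kb ≤ 1 → ka ≤ ∣ S ─ A ∣ → kb ≤ ∣ S ─ B ∣ →
  SameOrTwoLess (dist (concBy ka S A) (concBy kb S B)) (∣ ka - kb ∣ + dist (A ∩ S) (B ∩ S))
dist-concBy 0 0 S A B _ _ _  _  = inj₁ (cong₂ dist (concBy-zero S A) (concBy-zero S B))
dist-concBy 1 0 S A B _ _ hA _  = dist-concBy-one-zero S A B hA
dist-concBy 0 1 S A B _ _ _  hB = dist-concBy-zero-one S A B hB
dist-concBy 1 1 S A B _ _ hA hB = dist-concBy-one-one S A B hA hB
dist-concBy (suc (suc _)) _ S A B (s≤s ()) _ _ _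
dist-concBy _ (suc (suc _)) S A B _ (s≤s ()) _ _

conc-⊆ : (S A : Subset m) → conc S A ⊆ S
conc-⊆ S A x∈ = [ p∩q⊆q A S , p─q⊆p S A ∘ smallest-⊆ ∣ A ─ S ∣ (S ─ A) ] (x∈p∪q⁻ (A ∩ S) _ x∈)

module _ (S A : Subset m) (∣A∣≤∣S∣ : ∣ A ∣ ≤ ∣ S ∣) where

  private
    ∣smallest-S─A∣ : ∣ smallest (∣ A ─ S ∣) (S ─ A) ∣ ≡ ∣ A ─ S ∣
    ∣smallest-S─A∣ = ∣smallest∣ ∣ A ─ S ∣ (S ─ A) (∣p∣≤∣q∣⇒∣p─q∣≤∣q─p∣ A S ∣A∣≤∣S∣)

  ∣conc∣ : ∣ conc S A ∣ ≡ ∣ A ∣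
  ∣conc∣ = begin
    ∣ conc S A ∣                                   ≡⟨ ∣p∩q∪r∣≡∣p∩q∣+∣r∣ A S _ (smallest-⊆ ∣ A ─ S ∣ (S ─ A)) ⟩
    ∣ A ∩ S ∣ + ∣ smallest (∣ A ─ S ∣) (S ─ A) ∣ ≡⟨ cong (∣ A ∩ S ∣ +_) ∣smallest-S─A∣ ⟩
    ∣ A ∩ S ∣ + ∣ A ─ S ∣                         ≡⟨ ∣p∣≡∣p∩q∣+∣p─q∣ A S ⟨
    ∣ A ∣                                         ∎
    where open ≡-Reasoning

  dist-conc : dist A (conc S A) ≡ ∣ A ─ S ∣ + ∣ A ─ S ∣
  dist-conc = trans (dist-p∩q∪r A S _ (smallest-⊆ ∣ A ─ S ∣ (S ─ A))) (cong (∣ A ─ S ∣ +_) ∣smallest-S─A∣)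

conc-id : {S A : Subset m} → A ⊆ S → conc S A ≡ A
conc-id {m} {S} {A} A⊆S = begin
  conc S A     ≡⟨ cong (λ k → concBy k S A) (trans (cong ∣_∣ (p⊆q⇒p─q≡⊥ A⊆S)) (∣⊥∣≡0 m)) ⟩
  concBy 0 S A ≡⟨ concBy-zero S A ⟩
  A ∩ S        ≡⟨ p⊆q⇒p∩q≡p A⊆S ⟩
  A            ∎
  where open ≡-Reasoning

dist-conc-conc : {S S' A B : Subset m} → A ⊆ S' → B ⊆ S' → ∣ S' ─ S ∣ ≤ 1 → ∣ A ∣ ≤ ∣ S ∣ → ∣ B ∣ ≤ ∣ S ∣ →
  SameOrTwoLess (dist (conc S A) (conc S B)) (dist A B)
dist-conc-conc {S = S} {S'} {A} {B} A⊆S' B⊆S' ∣S'─S∣≤1 ∣A∣≤∣S∣ ∣B∣≤∣S∣ =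
  subst (SameOrTwoLess _) (sym dist-split)
    (dist-concBy ∣ A ─ S ∣ ∣ B ─ S ∣ S A B
      (≤-trans (p⊆q⇒∣p─r∣≤∣q─r∣ S A⊆S') ∣S'─S∣≤1) (≤-trans (p⊆q⇒∣p─r∣≤∣q─r∣ S B⊆S') ∣S'─S∣≤1)
      (∣p∣≤∣q∣⇒∣p─q∣≤∣q─p∣ A S ∣A∣≤∣S∣) (∣p∣≤∣q∣⇒∣p─q∣≤∣q─p∣ B S ∣B∣≤∣S∣))
  where
  dist-split : dist A B ≡ ∣ ∣ A ─ S ∣ - ∣ B ─ S ∣ ∣ + dist (A ∩ S) (B ∩ S)
  dist-split = trans (dist-─-∩ S A B)
    (cong (_+ dist (A ∩ S) (B ∩ S)) (dist-⊆-∣r∣≤1 (p⊆q⇒p─r⊆q─r S A⊆S') (p⊆q⇒p─r⊆q─r S B⊆S') ∣S'─S∣≤1))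

contraction⇒simplicial : ∀ {n} {S S' : Subset m} {f : Subset m → Subset m} →
  IsContraction n S S' f → ∀ r → IsSimplicialVR n S' S r f
contraction⇒simplicial {n = n} {S} {S'} {f} (f∈ , _ , f-lipschitz) r = f∈ , image
  where
  image : ∀ σ → IsVRSimplex n S' r σ → IsVRSimplex n S r (map f σ)
  image (A ∷ σ) (nonempty , σ⊆F , diam≤r) = nonempty , fσ⊆F , fdiam≤r
    where
    fσ⊆F : ∀ B → B ∈ map f (A ∷ σ) → InF n S B
    fσ⊆F B B∈ with ∈-map⁻ f B∈
    ... | C , C∈ , refl = f∈ C (σ⊆F C C∈)
    fdiam≤r : ∀ B C → B ∈ map f (A ∷ σ) → C ∈ map f (A ∷ σ) → dist B C ≤ r
    fdiam≤r B C B∈ C∈ with ∈-map⁻ f B∈ | ∈-map⁻ f C∈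
    ... | B' , B'∈ , refl | C' , C'∈ , refl =
      ≤-trans (f-lipschitz B' C' (σ⊆F B' B'∈) (σ⊆F C' C'∈)) (diam≤r B' C' B'∈ C'∈)

k≤1⇒k+k≡0⊎k+k≡2 : ∀ {k} → k ≤ 1 → k + k ≡ 0 ⊎ k + k ≡ 2
k≤1⇒k+k≡0⊎k+k≡2 z≤n       = inj₁ refl
k≤1⇒k+k≡0⊎k+k≡2 (s≤s z≤n) = inj₂ refl

lemma4p2 : (m n : ℕ) → suc n ≤ m → (S S' : Subset m) → S ⊆ S' → n ≤ ∣ S ∣ → ∣ S' ─ S ∣ ≡ 1 →
    ((∀ A → InF n S' A → (dist A (conc S A) ≡ 0) ⊎ (dist A (conc S A) ≡ 2)) ×
     (∀ A B → InF n S' A → InF n S' B → A ≢ B →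
        (dist (conc S A) (conc S B) ≡ dist A B) ⊎ (dist (conc S A) (conc S B) + 2 ≡ dist A B)) ×
     IsContraction n S S' (conc S) ×
     (∀ r → IsSimplicialVR n S' S r (conc S)))
lemma4p2 m n _ S S' _ n≤∣S∣ ∣S'─S∣≡1 =
  moves-0-or-2 , (λ A B A∈ B∈ _ → shrinks A∈ B∈) , contraction , contraction⇒simplicial contraction
  where
  ≤∣S∣ : ∀ {A} → InF n S' A → ∣ A ∣ ≤ ∣ S ∣
  ≤∣S∣ (_ , ∣A∣≡n) = ≤-trans (≤-reflexive ∣A∣≡n) n≤∣S∣
  moves-0-or-2 : ∀ A → InF n S' A → (dist A (conc S A) ≡ 0) ⊎ (dist A (conc S A) ≡ 2)
  moves-0-or-2 A A∈ =
    subst (λ d → d ≡ 0 ⊎ d ≡ 2) (sym (dist-conc S A (≤∣S∣ A∈)))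
      (k≤1⇒k+k≡0⊎k+k≡2 (≤-trans (p⊆q⇒∣p─r∣≤∣q─r∣ S (proj₁ A∈)) (≤-reflexive ∣S'─S∣≡1)))
  shrinks : ∀ {A B} → InF n S' A → InF n S' B → SameOrTwoLess (dist (conc S A) (conc S B)) (dist A B)
  shrinks A∈ B∈ = dist-conc-conc (proj₁ A∈) (proj₁ B∈) (≤-reflexive ∣S'─S∣≡1) (≤∣S∣ A∈) (≤∣S∣ B∈)
  contraction : IsContraction n S S' (conc S)
  contraction =
    (λ A A∈ → conc-⊆ S A , trans (∣conc∣ S A (≤∣S∣ A∈)) (proj₂ A∈)) ,
    (λ A A∈ → conc-id (proj₁ A∈)) ,
    (λ A B A∈ B∈ → SameOrTwoLess⇒≤ (shrinks A∈ B∈))
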